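{- Let $A$ and $B$ be subtraction algebras and $h:A\to B$ a homomorphism (i.e. $h(a-b)=h(a)-h(b)$). If $h$ is join complete, then it is meet complete.
   Context: A subtraction algebra is a set with a binary operation $-$ satisfying $a-(b-a)=a$, $a-(a-b)=b-(b-a)$, and $(a-b)-c=(a-c)-b$. Writing $a\cdot b:=a-(a-b)$, it is a meet-semilattice ordered by $a\le b\iff a\cdot b=a$, with least element $0=a-a$. A map $h:A\to B$ between posets is meet complete if for every nonempty $S\subseteq A$ whose meet $\bigwedge S$ exists in $A$, the meet of $h[S]$ exists in $B$ and equals $h(\bigwedge S)$; it is join complete if for every $S\subseteq A$ whose join $\bigvee S$ exists in $A$, the join of $h[S]$ exists in $B$ and equals $h(\bigvee S)$. -}

module Defs where

open import Level using (0ℓ)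
open import Data.Product using (Σ; ∃; _×_; _,_)
open import Relation.Binary.PropositionalEquality using (_≡_)
open import Relation.Unary using (Pred)

record SubtractionAlgebra : Set₁ where
  infixl 6 _-_
  field
    Carrier : Set
    _-_     : Carrier → Carrier → Carrier
    ax1 : ∀ a b → a - (b - a) ≡ a
    ax2 : ∀ a b → a - (a - b) ≡ b - (b - a)
    ax3 : ∀ a b c → (a - b) - c ≡ (a - c) - b

  _·_ : Carrier → Carrier → Carrier
  a · b = a - (a - b)

  _≤_ : Carrier → Carrier → Set
  a ≤ b = a · b ≡ a

open SubtractionAlgebra

IsHom : (A B : SubtractionAlgebra) → (Carrier A → Carrier B) → Set
IsHom A B h = ∀ a b → h (_-_ A a b) ≡ _-_ B (h a) (h b)

IsMeet : (A : SubtractionAlgebra) → Pred (Carrier A) 0ℓ → Carrier A → Set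
IsMeet A S m = (∀ x → S x → _≤_ A m x)
             × (∀ l → (∀ x → S x → _≤_ A l x) → _≤_ A l m)

IsJoin : (A : SubtractionAlgebra) → Pred (Carrier A) 0ℓ → Carrier A → Set
IsJoin A S j = (∀ x → S x → _≤_ A x j)
             × (∀ u → (∀ x → S x → _≤_ A x u) → _≤_ A j u)

Image : {X Y : Set} → (X → Y) → Pred X 0ℓ → Pred Y 0ℓ
Image h S y = ∃ λ x → S x × h x ≡ y

Nonempty : {X : Set} → Pred X 0ℓ → Set
Nonempty S = ∃ λ x → S x

MeetComplete : (A B : SubtractionAlgebra) → (Carrier A → Carrier B) → Set₁
MeetComplete A B h = (S : Pred (Carrier A) 0ℓ) → Nonempty S →
  (m : Carrier A) → IsMeet A S m → IsMeet B (Image h S) (h m)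

JoinComplete : (A B : SubtractionAlgebra) → (Carrier A → Carrier B) → Set₁
JoinComplete A B h = (S : Pred (Carrier A) 0ℓ) →
  (j : Carrier A) → IsJoin A S j → IsJoin B (Image h S) (h j)

-- Fix s₀ ∈ S. Since x ↦ s₀ - x is antitone and x - y ≤ z ⇔ x - z ≤ y, the meet m of S
-- turns into the join s₀ - m of {s₀ - s ∣ s ∈ S}. Join completeness makes h s₀ - h m the
-- join of {h s₀ - h s ∣ s ∈ S}, and the same Galois-type exchange in B turns this back into
-- h m being the greatest lower bound of h[S] (a lower bound l is recovered as h s₀ - (h s₀ - l)).
module Submission where

open import Defs
open import Level using (0ℓ)
open import Data.Product using (_,_; proj₁; proj₂)
open import Relation.Binary.PropositionalEquality using (_≡_; refl; sym; trans; cong; subst; module ≡-Reasoning)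
open import Relation.Unary using (Pred)

module SubtractionAlgebraProperties (A : SubtractionAlgebra) where
  open SubtractionAlgebra A
  open ≡-Reasoning

  x-y-y≡x-y : ∀ x y → (x - y) - y ≡ x - y
  x-y-y≡x-y x y = begin
    (x - y) - y             ≡⟨ cong ((x - y) -_) (sym (ax1 y x)) ⟩
    (x - y) - (y - (x - y)) ≡⟨ ax1 (x - y) y ⟩
    x - y                   ∎

  x-x≡[y-x]-[y-x] : ∀ x y → x - x ≡ (y - x) - (y - x)
  x-x≡[y-x]-[y-x] x y = begin
    x - x                   ≡⟨ cong (x -_) (sym (ax1 x y)) ⟩
    x - (x - (y - x))       ≡⟨ ax2 x (y - x) ⟩
    (y - x) - ((y - x) - x) ≡⟨ cong ((y - x) -_) (x-y-y≡x-y y x) ⟩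
    (y - x) - (y - x)       ∎

  x-x≡y-y : ∀ x y → x - x ≡ y - y
  x-x≡y-y x y = begin
    x - x                                 ≡⟨ x-x≡[y-x]-[y-x] x (x - y) ⟩
    ((x - y) - x) - ((x - y) - x)         ≡⟨ cong (λ t → t - t) (ax3 x y x) ⟩
    ((x - x) - y) - ((x - x) - y)         ≡⟨ sym (x-x≡[y-x]-[y-x] y (x - x)) ⟩
    y - y                                 ∎

  x-0≡x : ∀ x y → x - (y - y) ≡ x
  x-0≡x x y = trans (cong (x -_) (x-x≡y-y y x)) (ax1 x x)

  0-x≡0 : ∀ x y → (y - y) - x ≡ y - y
  0-x≡0 x y = trans (cong (_- x) (x-x≡y-y y x)) (trans (x-y-y≡x-y x x) (x-x≡y-y x y))

  ≤⇒-≡0 : ∀ {x y} → x ≤ y → x - y ≡ x - x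
  ≤⇒-≡0 {x} {y} x≤y = begin
    x - y                 ≡⟨ cong (_- y) (sym x≤y) ⟩
    (x - (x - y)) - y     ≡⟨ ax3 x (x - y) y ⟩
    (x - y) - (x - y)     ≡⟨ x-x≡y-y (x - y) x ⟩
    x - x                 ∎

  -≡0⇒≤ : ∀ {x y z} → x - y ≡ z - z → x ≤ y
  -≡0⇒≤ {x} {y} {z} x-y≡0 = trans (cong (x -_) x-y≡0) (x-0≡x x z)

  ·-comm : ∀ x y → x · y ≡ y · x
  ·-comm = ax2

  -‿exchange : ∀ {x y z} → (x - y) ≤ z → (x - z) ≤ y
  -‿exchange {x} {y} {z} x-y≤z = -≡0⇒≤ (trans (ax3 x z y) (≤⇒-≡0 x-y≤z))

  -‿antitoneʳ : ∀ x {y z} → y ≤ z → (x - z) ≤ (x - y)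
  -‿antitoneʳ x {y} {z} y≤z = -≡0⇒≤ (begin
    (x - z) - (x - y)         ≡⟨ ax3 x z (x - y) ⟩
    (x - (x - y)) - z         ≡⟨ cong (_- z) (ax2 x y) ⟩
    (y - (y - x)) - z         ≡⟨ ax3 y (y - x) z ⟩
    (y - z) - (y - x)         ≡⟨ cong (_- (y - x)) (≤⇒-≡0 y≤z) ⟩
    (y - y) - (y - x)         ≡⟨ 0-x≡0 (y - x) y ⟩
    y - y                     ∎)

  meet⇒join-of-differences : ∀ {S m} a → IsMeet A S m → IsJoin A (Image (a -_) S) (a - m)
  meet⇒join-of-differences a (m-lower , m-greatest) =
      (λ { _ (s , s∈S , refl) → -‿antitoneʳ a (m-lower s s∈S) })
    , λ u u-upper → -‿exchange (m-greatest (a - u) λ s s∈S →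
                                  -‿exchange (u-upper (a - s) (s , s∈S , refl)))

  lower-bound-below-meet-of-differences :
    ∀ {S : Pred Carrier 0ℓ} {m l a} → (∀ u → (∀ s → S s → (a - s) ≤ u) → (a - m) ≤ u) →
    (∀ s → S s → l ≤ s) → l ≤ a → l ≤ m
  lower-bound-below-meet-of-differences {S} {m} {l} {a} a-m-least l-lower l≤a =
    subst (_≤ m) a·l≡l (-‿exchange (a-m-least (a - l) λ s s∈S → -‿antitoneʳ a (l-lower s s∈S)))
    where
    a·l≡l : a · l ≡ l
    a·l≡l = trans (·-comm a l) l≤a

module _ (A B : SubtractionAlgebra) {h : SubtractionAlgebra.Carrier A → SubtractionAlgebra.Carrier B}
         (hom : IsHom A B h) where
  open SubtractionAlgebra

  hom-monotone : ∀ {x y} → _≤_ A x y → _≤_ B (h x) (h y)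
  hom-monotone {x} {y} x≤y = begin
    _-_ B (h x) (_-_ B (h x) (h y)) ≡⟨ cong (_-_ B (h x)) (sym (hom x y)) ⟩
    _-_ B (h x) (h (_-_ A x y))     ≡⟨ sym (hom x (_-_ A x y)) ⟩
    h (_·_ A x y)                   ≡⟨ cong h x≤y ⟩
    h x                             ∎
    where open ≡-Reasoning

  hom-image-of-differences : ∀ {S a y} → Image h (Image (_-_ A a) S) y → Image (_-_ B (h a)) (Image h S) y
  hom-image-of-differences {a = a} (_ , (s , s∈S , refl) , refl) = h s , (s , s∈S , refl) , sym (hom a s)

corollary6p6 : (A B : SubtractionAlgebra) (h : SubtractionAlgebra.Carrier A → SubtractionAlgebra.Carrier B)
    → IsHom A B h → JoinComplete A B h → MeetComplete A B h
corollary6p6 A B h hom joinComplete S (s₀ , s₀∈S) m m-meet = hm-lower , hm-greatest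
  where
  open SubtractionAlgebra
  module PA = SubtractionAlgebraProperties A
  module PB = SubtractionAlgebraProperties B

  hm-lower : ∀ y → Image h S y → _≤_ B (h m) y
  hm-lower _ (s , s∈S , refl) = hom-monotone A B hom (proj₁ m-meet s s∈S)

  h[s₀-m]-join : IsJoin B (Image h (Image (_-_ A s₀) S)) (h (_-_ A s₀ m))
  h[s₀-m]-join = joinComplete _ _ (PA.meet⇒join-of-differences s₀ m-meet)

  hs₀-hm-least : ∀ u → (∀ t → Image h S t → _≤_ B (_-_ B (h s₀) t) u) → _≤_ B (_-_ B (h s₀) (h m)) u
  hs₀-hm-least u u-upper = subst (λ v → _≤_ B v u) (hom s₀ m) (proj₂ h[s₀-m]-join u λ y y∈ →
    below-u (hom-image-of-differences A B hom y∈))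
    where
    below-u : ∀ {y} → Image (_-_ B (h s₀)) (Image h S) y → _≤_ B y u
    below-u (t , t∈h[S] , refl) = u-upper t t∈h[S]

  hm-greatest : ∀ l → (∀ y → Image h S y → _≤_ B l y) → _≤_ B l (h m)
  hm-greatest l l-lower = PB.lower-bound-below-meet-of-differences hs₀-hm-least l-lower
                            (l-lower (h s₀) (s₀ , s₀∈S , refl))
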